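{- Let $B$ be a circuitous base of a matroid $M$, and let $F\subsetneq G$ be flats of $M$, each spanned by a subset of $B$. If $G$ is connected, then the matroid $G/F$ is connected.
   Context: For a base $B$ of $M$ and an element $e\notin B$, the basic circuit $C(B,e)$ is the unique circuit contained in $B\cup\{e\}$. A flat is connected if the restriction of $M$ to it is a connected matroid. A base $B$ is circuitous if every connected flat spanned by a subset of $B$ is the closure of $C(B,e)$ for some element $e\notin B$. $G/F$ denotes the matroid on $G\setminus F$ obtained from the restriction $M|_G$ by contracting $F$. -}

module Defs where

open import Data.Nat using (ℕ; _≤_; _<_; _+_; _∸_)
open import Data.Nat.Properties using (_≟_)
open import Data.Fin using (Fin)
open import Data.Fin.Subset using (Subset; _∈_; _∉_; _⊆_; _∪_; _∩_; _─_; _-_; ⁅_⁆; ∣_∣; ⊤; Nonempty)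
open import Data.Vec using (tabulate)
open import Data.Bool using (true; false)
open import Data.Product using (_×_; ∃; ∃-syntax)
open import Relation.Binary.PropositionalEquality using (_≡_; _≢_)
open import Relation.Nullary.Decidable using (⌊_⌋)

record Matroid (n : ℕ) : Set where
  field
    rank      : Subset n → ℕ
    rank-≤    : ∀ X → rank X ≤ ∣ X ∣
    rank-mono : ∀ {X Y} → X ⊆ Y → rank X ≤ rank Y
    rank-sub  : ∀ X Y → rank (X ∪ Y) + rank (X ∩ Y) ≤ rank X + rank Y

-- Notions relative to a rank function ρ on subsets of a ground set E ⊆ Fin n.
-- (Used for M itself, restrictions M|G and minors G/F.)

IsCircuitᵣ : ∀ {n} → (Subset n → ℕ) → Subset n → Set
IsCircuitᵣ ρ C = ρ C < ∣ C ∣ × (∀ e → e ∈ C → ρ (C - e) ≡ ∣ C - e ∣)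

IsConnectedᵣ : ∀ {n} → (Subset n → ℕ) → Subset n → Set
IsConnectedᵣ ρ E =
  Nonempty E ×
  (∀ e f → e ∈ E → f ∈ E → e ≢ f →
     ∃[ C ] (C ⊆ E × IsCircuitᵣ ρ C × e ∈ C × f ∈ C))

module _ {n : ℕ} (M : Matroid n) where
  open Matroid M

  IsIndependent : Subset n → Set
  IsIndependent X = rank X ≡ ∣ X ∣

  IsBase : Subset n → Set
  IsBase B = IsIndependent B × rank B ≡ rank ⊤

  IsCircuit : Subset n → Set
  IsCircuit = IsCircuitᵣ rank

  cl : Subset n → Subset n
  cl X = tabulate (λ e → ⌊ rank (X ∪ ⁅ e ⁆) ≟ rank X ⌋)

  IsFlat : Subset n → Set
  IsFlat F = cl F ≡ F

  SpannedBySubsetOf : Subset n → Subset n → Set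
  SpannedBySubsetOf B F = ∃[ S ] (S ⊆ B × cl S ≡ F)

  IsConnectedFlat : Subset n → Set
  IsConnectedFlat G = IsFlat G × IsConnectedᵣ rank G

  -- C is a circuit contained in B ∪ {e}  (the basic circuit C(B,e), unique when B is a base)
  IsBasicCircuit : Subset n → Fin n → Subset n → Set
  IsBasicCircuit B e C = IsCircuit C × C ⊆ B ∪ ⁅ e ⁆

  IsCircuitous : Subset n → Set
  IsCircuitous B =
    IsBase B ×
    (∀ F → IsConnectedFlat F → SpannedBySubsetOf B F →
       ∃[ e ] (e ∉ B × ∃[ C ] (IsBasicCircuit B e C × cl C ≡ F)))

  -- rank function of the minor G/F = (M|G)/F on ground set G ∖ F:
  -- r_{G/F}(X) = r(X ∪ F) − r(F)
  contractRank : Subset n → Subset n → ℕ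
  contractRank F X = rank (X ∪ F) ∸ rank F

  IsConnectedMinor : Subset n → Subset n → Set
  IsConnectedMinor G F = IsConnectedᵣ (contractRank F) (G ─ F)

-- Circuitousness gives a basic circuit C with cl C = G. A counting argument shows
-- B ∩ G ⊆ C, so C ∩ F contains the basis B ∩ F of F; as C ⊈ F it is independent,
-- hence |C ∩ F| = r(F). Then C ∖ F is a circuit of G/F of rank r(G) − r(F), so it
-- spans G/F, and G/F has no loops because F is a flat. A loopless matroid with a
-- spanning circuit is connected.

module Submission where

open import Defs
open import Data.Nat using (ℕ; suc; _+_; _∸_; _≤_; _<_; z≤n; s≤s; s≤s⁻¹)
open import Data.Nat.Properties
open import Algebra.Properties.CommutativeSemigroup +-commutativeSemigroup using (interchange)
open import Data.Nat.Induction using (<-wellFounded)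
open import Data.Fin using (Fin)
open import Data.Fin.Properties using (any?)
open import Data.Fin.Subset
open import Data.Fin.Subset.Properties
open import Data.Vec using ([]; _∷_; there)
open import Data.Bool using (Bool; true; false)
open import Data.Product using (_×_; _,_; proj₁; proj₂; ∃-syntax)
open import Data.Sum using (_⊎_; inj₁; inj₂)
open import Function.Base using (_∘_)
open import Data.Empty using (⊥-elim) renaming (⊥ to False)
open import Induction.WellFounded using (Acc; acc)
open import Relation.Nullary using (¬_; yes; no; Dec)
open import Relation.Nullary.Decidable using (_×-dec_; ¬?; ⌊_⌋; toWitness; dec-true; isYes≗does)
open import Data.Bool.Properties using (T-≡)
open import Data.Vec.Properties using ([]=⇒lookup; lookup⇒[]=; lookup∘tabulate)
open import Function.Bundles using (Equivalence)
open import Relation.Binary.PropositionalEquality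

private
  variable
    n : ℕ
    x y : Fin n
    p q r : Subset n

-- Finite subsets

x∈p─q⇒x∉q : ∀ (p q : Subset n) → x ∈ p ─ q → x ∉ q
x∈p─q⇒x∉q (s ∷ p) (true  ∷ q) (there x∈) (there x∈q) = x∈p─q⇒x∉q p q x∈ x∈q
x∈p─q⇒x∉q (s ∷ p) (false ∷ q) (there x∈) (there x∈q) = x∈p─q⇒x∉q p q x∈ x∈q

x∈p-y⇒x≢y : ∀ (p : Subset n) → x ∈ p - y → x ≢ y
x∈p-y⇒x≢y p x∈ = x∉⁅y⁆⇒x≢y (x∈p─q⇒x∉q p _ x∈)

∪-lub : p ⊆ r → q ⊆ r → p ∪ q ⊆ r
∪-lub {p = p} {q = q} p⊆r q⊆r x∈ with x∈p∪q⁻ p q x∈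
... | inj₁ x∈p = p⊆r x∈p
... | inj₂ x∈q = q⊆r x∈q

∪-mono : ∀ {p′ q′ : Subset n} → p ⊆ p′ → q ⊆ q′ → p ∪ q ⊆ p′ ∪ q′
∪-mono {p′ = p′} {q′} p⊆p′ q⊆q′ = ∪-lub (⊆-trans p⊆p′ (p⊆p∪q q′)) (⊆-trans q⊆q′ (q⊆p∪q p′ q′))

p⊆q∪⁅x⁆∧x∉p⇒p⊆q : p ⊆ q ∪ ⁅ x ⁆ → x ∉ p → p ⊆ q
p⊆q∪⁅x⁆∧x∉p⇒p⊆q {q = q} {x = x} p⊆q∪x x∉p {y} y∈p with x∈p∪q⁻ q _ (p⊆q∪x y∈p)
... | inj₁ y∈q = y∈q
... | inj₂ y∈x = ⊥-elim (x∉p (subst (_∈ _) (x∈⁅y⁆⇒x≡y x y∈x) y∈p))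

∪-swapʳ : ∀ (p q r : Subset n) → (p ∪ q) ∪ r ≡ (p ∪ r) ∪ q
∪-swapʳ p q r = begin
  (p ∪ q) ∪ r  ≡⟨ ∪-assoc p q r ⟩
  p ∪ (q ∪ r)  ≡⟨ cong (p ∪_) (∪-comm q r) ⟩
  p ∪ (r ∪ q)  ≡⟨ ∪-assoc p r q ⟨
  (p ∪ r) ∪ q  ∎
  where open ≡-Reasoning

x∈p⇒⁅x⁆⊆p : x ∈ p → ⁅ x ⁆ ⊆ p
x∈p⇒⁅x⁆⊆p {x = x} x∈p y∈ = subst (_∈ _) (sym (x∈⁅y⁆⇒x≡y x y∈)) x∈p

x∉p⇒p-x≡p : x ∉ p → p - x ≡ p
x∉p⇒p-x≡p {p = p} x∉p = ⊆-antisym (p─q⊆p p _) (λ y∈p → x∈p∧x≢y⇒x∈p-y y∈p λ { refl → x∉p y∈p })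

─-monoˡ : p ⊆ q → p ─ r ⊆ q ─ r
─-monoˡ {p = p} {r = r} p⊆q x∈p─r = x∈p∧x∉q⇒x∈p─q (p⊆q (p─q⊆p p r x∈p─r)) (x∈p─q⇒x∉q p r x∈p─r)

p-x⊆p─q-x∪q : ∀ (p q : Subset n) x → p - x ⊆ ((p ─ q) - x) ∪ q
p-x⊆p─q-x∪q p q x {y} y∈p-x with y ∈? q
... | yes y∈q = q⊆p∪q _ q y∈q
... | no  y∉q = p⊆p∪q q (x∈p∧x≢y⇒x∈p-y (x∈p∧x∉q⇒x∈p─q (p─q⊆p p _ y∈p-x) y∉q) (x∈p-y⇒x≢y p y∈p-x))

⊈⇒∃∉ : ¬ p ⊆ q → ∃[ x ] (x ∈ p × x ∉ q)
⊈⇒∃∉ {p = p} {q = q} p⊈q with nonempty? (p ─ q)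
... | yes (x , x∈p─q) = x , p─q⊆p p q x∈p─q , x∈p─q⇒x∉q p q x∈p─q
... | no  empty       = ⊥-elim (p⊈q p⊆q)
  where
  p⊆q : p ⊆ q
  p⊆q {x} x∈p with x ∈? q
  ... | yes x∈q = x∈q
  ... | no  x∉q = ⊥-elim (empty (x , x∈p∧x∉q⇒x∈p─q x∈p x∉q))

x∈p⇒p∪⁅x⁆≡p : x ∈ p → p ∪ ⁅ x ⁆ ≡ p
x∈p⇒p∪⁅x⁆≡p x∈p = ⊆-antisym (∪-lub ⊆-refl (x∈p⇒⁅x⁆⊆p x∈p)) (p⊆p∪q _)

x∉p∧x≢y⇒x∉p∪⁅y⁆ : x ∉ p → x ≢ y → x ∉ p ∪ ⁅ y ⁆
x∉p∧x≢y⇒x∉p∪⁅y⁆ {p = p} {y = y} x∉p x≢y x∈ with x∈p∪q⁻ p _ x∈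
... | inj₁ x∈p = x∉p x∈p
... | inj₂ x∈y = x≢y (x∈⁅y⁆⇒x≡y y x∈y)

p⊆p─q∪q : ∀ (p q : Subset n) → p ⊆ (p ─ q) ∪ q
p⊆p─q∪q p q {x} x∈p with x ∈? q
... | yes x∈q = q⊆p∪q _ q x∈q
... | no  x∉q = p⊆p∪q q (x∈p∧x∉q⇒x∈p─q x∈p x∉q)

∣p∪q∣+∣p∩q∣≡∣p∣+∣q∣ : ∀ (p q : Subset n) → ∣ p ∪ q ∣ + ∣ p ∩ q ∣ ≡ ∣ p ∣ + ∣ q ∣
∣p∪q∣+∣p∩q∣≡∣p∣+∣q∣ []          []          = refl
∣p∪q∣+∣p∩q∣≡∣p∣+∣q∣ (true  ∷ p) (true  ∷ q) =
  cong suc (trans (+-suc _ _) (trans (cong suc (∣p∪q∣+∣p∩q∣≡∣p∣+∣q∣ p q)) (sym (+-suc _ _))))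
∣p∪q∣+∣p∩q∣≡∣p∣+∣q∣ (true  ∷ p) (false ∷ q) = cong suc (∣p∪q∣+∣p∩q∣≡∣p∣+∣q∣ p q)
∣p∪q∣+∣p∩q∣≡∣p∣+∣q∣ (false ∷ p) (true  ∷ q) =
  trans (cong suc (∣p∪q∣+∣p∩q∣≡∣p∣+∣q∣ p q)) (sym (+-suc _ _))
∣p∪q∣+∣p∩q∣≡∣p∣+∣q∣ (false ∷ p) (false ∷ q) = ∣p∪q∣+∣p∩q∣≡∣p∣+∣q∣ p q

∣p∪q∣≤∣p∣+∣q∣ : ∀ (p q : Subset n) → ∣ p ∪ q ∣ ≤ ∣ p ∣ + ∣ q ∣
∣p∪q∣≤∣p∣+∣q∣ p q = ≤-trans (m≤m+n _ ∣ p ∩ q ∣) (≤-reflexive (∣p∪q∣+∣p∩q∣≡∣p∣+∣q∣ p q))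

∣p∣≡∣p∩q∣+∣p─q∣ : ∀ (p q : Subset n) → ∣ p ∣ ≡ ∣ p ∩ q ∣ + ∣ p ─ q ∣
∣p∣≡∣p∩q∣+∣p─q∣ []          []          = refl
∣p∣≡∣p∩q∣+∣p─q∣ (true  ∷ p) (true  ∷ q) = cong suc (∣p∣≡∣p∩q∣+∣p─q∣ p q)
∣p∣≡∣p∩q∣+∣p─q∣ (true  ∷ p) (false ∷ q) = trans (cong suc (∣p∣≡∣p∩q∣+∣p─q∣ p q)) (sym (+-suc _ _))
∣p∣≡∣p∩q∣+∣p─q∣ (false ∷ p) (true  ∷ q) = ∣p∣≡∣p∩q∣+∣p─q∣ p q
∣p∣≡∣p∩q∣+∣p─q∣ (false ∷ p) (false ∷ q) = ∣p∣≡∣p∩q∣+∣p─q∣ p q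

p⊆q⇒∣q∣≡∣p∣+∣q─p∣ : p ⊆ q → ∣ q ∣ ≡ ∣ p ∣ + ∣ q ─ p ∣
p⊆q⇒∣q∣≡∣p∣+∣q─p∣ {p = p} {q = q} p⊆q =
  trans (∣p∣≡∣p∩q∣+∣p─q∣ q p) (cong (λ s → ∣ s ∣ + ∣ q ─ p ∣) q∩p≡p)
  where
  q∩p≡p : q ∩ p ≡ p
  q∩p≡p = ⊆-antisym (p∩q⊆q q p) (λ x∈p → x∈p∩q⁺ (p⊆q x∈p , x∈p))

Empty⇒∣p∣≡0 : ∀ {n} {p : Subset n} → Empty p → ∣ p ∣ ≡ 0
Empty⇒∣p∣≡0 {n} empty = trans (cong ∣_∣ (Empty-unique empty)) (∣⊥∣≡0 n)

disjoint⇒∣p∪q∣≡∣p∣+∣q∣ : (∀ {x} → x ∈ p → x ∉ q) → ∣ p ∪ q ∣ ≡ ∣ p ∣ + ∣ q ∣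
disjoint⇒∣p∪q∣≡∣p∣+∣q∣ {p = p} {q = q} disjoint = begin
  ∣ p ∪ q ∣              ≡⟨ sym (+-identityʳ _) ⟩
  ∣ p ∪ q ∣ + 0          ≡⟨ cong (∣ p ∪ q ∣ +_) (sym ∣p∩q∣≡0) ⟩
  ∣ p ∪ q ∣ + ∣ p ∩ q ∣  ≡⟨ ∣p∪q∣+∣p∩q∣≡∣p∣+∣q∣ p q ⟩
  ∣ p ∣ + ∣ q ∣          ∎
  where
  open ≡-Reasoning
  ∣p∩q∣≡0 : ∣ p ∩ q ∣ ≡ 0
  ∣p∩q∣≡0 = Empty⇒∣p∣≡0 (λ (_ , x∈) → let (x∈p , x∈q) = x∈p∩q⁻ p q x∈ in disjoint x∈p x∈q)

x∉p⇒∣p∪⁅x⁆∣≡1+∣p∣ : x ∉ p → ∣ p ∪ ⁅ x ⁆ ∣ ≡ suc ∣ p ∣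
x∉p⇒∣p∪⁅x⁆∣≡1+∣p∣ {x = x} {p = p} x∉p =
  trans (disjoint⇒∣p∪q∣≡∣p∣+∣q∣ (λ y∈p y∈⁅x⁆ → x∉p (subst (_∈ p) (x∈⁅y⁆⇒x≡y x y∈⁅x⁆) y∈p)))
        (trans (cong (∣ p ∣ +_) (∣⁅x⁆∣≡1 x)) (+-comm _ 1))

x∈p⇒∣p∣≡1+∣p-x∣ : x ∈ p → ∣ p ∣ ≡ suc ∣ p - x ∣
x∈p⇒∣p∣≡1+∣p-x∣ {x = x} {p = p} x∈p =
  trans (p⊆q⇒∣q∣≡∣p∣+∣q─p∣ (x∈p⇒⁅x⁆⊆p x∈p)) (cong (_+ ∣ p - x ∣) (∣⁅x⁆∣≡1 x))

x≢y⇒p∪⁅x⁆∩p∪⁅y⁆≡p : x ≢ y → (p ∪ ⁅ x ⁆) ∩ (p ∪ ⁅ y ⁆) ≡ p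
x≢y⇒p∪⁅x⁆∩p∪⁅y⁆≡p {x = x} {y = y} {p = p} x≢y = begin
  (p ∪ ⁅ x ⁆) ∩ (p ∪ ⁅ y ⁆)  ≡⟨ ∪-distribˡ-∩ p ⁅ x ⁆ ⁅ y ⁆ ⟨
  p ∪ (⁅ x ⁆ ∩ ⁅ y ⁆)        ≡⟨ cong (p ∪_) (Empty-unique disjoint) ⟩
  p ∪ ⊥                      ≡⟨ ∪-identityʳ p ⟩
  p                          ∎
  where
  open ≡-Reasoning
  disjoint : Empty (⁅ x ⁆ ∩ ⁅ y ⁆)
  disjoint (z , z∈) with x∈p∩q⁻ ⁅ x ⁆ ⁅ y ⁆ z∈
  ... | z∈⁅x⁆ , z∈⁅y⁆ = x≢y (trans (sym (x∈⁅y⁆⇒x≡y x z∈⁅x⁆)) (x∈⁅y⁆⇒x≡y y z∈⁅y⁆))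

∣p∪⁅x⁆∪p∪⁅y⁆∣≡2+∣p∣ : x ≢ y → x ∉ p → y ∉ p → ∣ (p ∪ ⁅ x ⁆) ∪ (p ∪ ⁅ y ⁆) ∣ ≡ suc (suc ∣ p ∣)
∣p∪⁅x⁆∪p∪⁅y⁆∣≡2+∣p∣ {x = x} {y = y} {p = p} x≢y x∉p y∉p = +-cancelʳ-≡ ∣ p ∣ _ _ (begin
  ∣ (p ∪ ⁅ x ⁆) ∪ (p ∪ ⁅ y ⁆) ∣ + ∣ p ∣
    ≡⟨ cong (λ q → ∣ (p ∪ ⁅ x ⁆) ∪ (p ∪ ⁅ y ⁆) ∣ + ∣ q ∣) (x≢y⇒p∪⁅x⁆∩p∪⁅y⁆≡p {p = p} x≢y) ⟨
  ∣ (p ∪ ⁅ x ⁆) ∪ (p ∪ ⁅ y ⁆) ∣ + ∣ (p ∪ ⁅ x ⁆) ∩ (p ∪ ⁅ y ⁆) ∣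
    ≡⟨ ∣p∪q∣+∣p∩q∣≡∣p∣+∣q∣ (p ∪ ⁅ x ⁆) (p ∪ ⁅ y ⁆) ⟩
  ∣ p ∪ ⁅ x ⁆ ∣ + ∣ p ∪ ⁅ y ⁆ ∣
    ≡⟨ cong₂ _+_ (x∉p⇒∣p∪⁅x⁆∣≡1+∣p∣ x∉p) (x∉p⇒∣p∪⁅x⁆∣≡1+∣p∣ y∉p) ⟩
  suc ∣ p ∣ + suc ∣ p ∣
    ≡⟨ cong suc (+-suc ∣ p ∣ ∣ p ∣) ⟩
  suc (suc ∣ p ∣) + ∣ p ∣ ∎)
  where open ≡-Reasoning

1≤∣p∣⇒Nonempty : 1 ≤ ∣ p ∣ → Nonempty p
1≤∣p∣⇒Nonempty {p = p} 1≤∣p∣ with nonempty? p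
... | yes nonempty = nonempty
... | no  empty    = ⊥-elim (1+n≰n (≤-trans 1≤∣p∣ (≤-reflexive (Empty⇒∣p∣≡0 empty))))

2≤∣p∣⇒distinct-pair : 2 ≤ ∣ p ∣ → ∃[ a ] ∃[ b ] (a ∈ p × b ∈ p × a ≢ b)
2≤∣p∣⇒distinct-pair {p = p} 2≤∣p∣ with 1≤∣p∣⇒Nonempty (≤-trans (s≤s z≤n) 2≤∣p∣)
... | a , a∈p with 1≤∣p∣⇒Nonempty {p = p - a} (s≤s⁻¹ (≤-trans 2≤∣p∣ (≤-reflexive (x∈p⇒∣p∣≡1+∣p-x∣ a∈p))))
...   | b , b∈p-a = a , b , a∈p , p─q⊆p p _ b∈p-a , λ a≡b → x∈p-y⇒x≢y p b∈p-a (sym a≡b)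

AtMostOne : Subset n → (Fin n → Set) → Set
AtMostOne p P = ∀ {a b} → a ∈ p → b ∈ p → a ≢ b → P a → P b → False

AtMostOne-all⇒2≰∣p∣ : ∀ {P : Fin n → Set} → (∀ {a} → a ∈ p → P a) → AtMostOne p P → ¬ 2 ≤ ∣ p ∣
AtMostOne-all⇒2≰∣p∣ all atMostOne 2≤∣p∣ with 2≤∣p∣⇒distinct-pair 2≤∣p∣
... | a , b , a∈p , b∈p , a≢b = atMostOne a∈p b∈p a≢b (all a∈p) (all b∈p)

AtMostOne-cover⇒3≰∣p∣ : ∀ {P Q : Fin n → Set} → (∀ {a} → a ∈ p → P a ⊎ Q a) →
                        AtMostOne p P → AtMostOne p Q → ¬ 3 ≤ ∣ p ∣
AtMostOne-cover⇒3≰∣p∣ {p = p} {P} {Q} cover oneP oneQ 3≤∣p∣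
  with 1≤∣p∣⇒Nonempty (≤-trans (s≤s z≤n) 3≤∣p∣)
... | a , a∈p with 2≤∣p∣⇒distinct-pair {p = p - a} (s≤s⁻¹ (≤-trans 3≤∣p∣ (≤-reflexive (x∈p⇒∣p∣≡1+∣p-x∣ a∈p))))
...   | b , c , b∈p-a , c∈p-a , b≢c = pigeon (cover a∈p) (cover b∈p) (cover c∈p)
  where
  b∈p : b ∈ p
  b∈p = p─q⊆p p _ b∈p-a
  c∈p : c ∈ p
  c∈p = p─q⊆p p _ c∈p-a
  a≢b : a ≢ b
  a≢b a≡b = x∈p-y⇒x≢y p b∈p-a (sym a≡b)
  a≢c : a ≢ c
  a≢c a≡c = x∈p-y⇒x≢y p c∈p-a (sym a≡c)
  pigeon : P a ⊎ Q a → P b ⊎ Q b → P c ⊎ Q c → False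
  pigeon (inj₁ Pa) (inj₁ Pb) _         = oneP a∈p b∈p a≢b Pa Pb
  pigeon (inj₂ Qa) (inj₂ Qb) _         = oneQ a∈p b∈p a≢b Qa Qb
  pigeon (inj₁ Pa) (inj₂ _)  (inj₁ Pc) = oneP a∈p c∈p a≢c Pa Pc
  pigeon (inj₁ _)  (inj₂ Qb) (inj₂ Qc) = oneQ b∈p c∈p b≢c Qb Qc
  pigeon (inj₂ _)  (inj₁ Pb) (inj₁ Pc) = oneP b∈p c∈p b≢c Pb Pc
  pigeon (inj₂ Qa) (inj₁ _)  (inj₂ Qc) = oneQ a∈p c∈p a≢c Qa Qc

IsMaximalIn : Subset n → (Subset n → Set) → Subset n → Set
IsMaximalIn D P J = J ⊆ D × P J × (∀ {w} → w ∈ D ─ J → ¬ P (J ∪ ⁅ w ⁆))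

module _ (P : Subset n → Set) (P? : ∀ J → Dec (P J)) (D : Subset n) where

  maximal-extension : ∀ {J} → J ⊆ D → P J → ∃[ K ] IsMaximalIn D P K
  maximal-extension {J} J⊆D PJ = go J J⊆D PJ (<-wellFounded ∣ D ─ J ∣)
    where
    go : ∀ J → J ⊆ D → P J → Acc _<_ ∣ D ─ J ∣ → ∃[ K ] IsMaximalIn D P K
    go J J⊆D PJ (acc smaller) with any? (λ w → (w ∈? D ─ J) ×-dec P? (J ∪ ⁅ w ⁆))
    ... | no  noExtension = J , J⊆D , PJ , λ w∈ Pw → noExtension (_ , w∈ , Pw)
    ... | yes (w , w∈ , Pw) =
      go (J ∪ ⁅ w ⁆) (∪-lub J⊆D (x∈p⇒⁅x⁆⊆p (p─q⊆p D J w∈))) Pw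
         (smaller (subst (λ s → ∣ s ∣ < ∣ D ─ J ∣) (p─q─r≡p─q∪r D J ⁅ w ⁆) (x∈p⇒∣p-x∣<∣p∣ w∈)))

∸-mono-+-≤ : ∀ {a b c d} f → f ≤ a → f ≤ b → a + b ≤ c + d → (a ∸ f) + (b ∸ f) ≤ (c ∸ f) + (d ∸ f)
∸-mono-+-≤ {a} {b} {c} {d} f f≤a f≤b a+b≤c+d = +-cancelʳ-≤ (f + f) _ _ (begin
  ((a ∸ f) + (b ∸ f)) + (f + f)  ≡⟨ interchange (a ∸ f) (b ∸ f) f f ⟩
  ((a ∸ f) + f) + ((b ∸ f) + f)  ≡⟨ cong₂ _+_ (m∸n+n≡m f≤a) (m∸n+n≡m f≤b) ⟩
  a + b                          ≤⟨ a+b≤c+d ⟩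
  c + d                          ≤⟨ +-mono-≤ (m≤n+m∸n c f) (m≤n+m∸n d f) ⟩
  (f + (c ∸ f)) + (f + (d ∸ f))  ≡⟨ interchange f (c ∸ f) f (d ∸ f) ⟩
  (f + f) + ((c ∸ f) + (d ∸ f))  ≡⟨ +-comm (f + f) _ ⟩
  ((c ∸ f) + (d ∸ f)) + (f + f)  ∎)
  where open ≤-Reasoning

-- Rank, closure and circuits

module _ (N : Matroid n) where
  open Matroid N

  private
    variable
      A B C F X Y Z : Subset n

  rank-submodular-⊆ : Z ⊆ X ∪ Y → A ⊆ X ∩ Y → rank Z + rank A ≤ rank X + rank Y
  rank-submodular-⊆ {X = X} {Y = Y} Z⊆X∪Y A⊆X∩Y =
    ≤-trans (+-mono-≤ (rank-mono Z⊆X∪Y) (rank-mono A⊆X∩Y)) (rank-sub X Y)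

  rank-∪≤ : ∀ X Y → rank (X ∪ Y) ≤ rank X + rank Y
  rank-∪≤ X Y = ≤-trans (m≤m+n _ (rank (X ∩ Y))) (rank-sub X Y)

  independent-⊆ : Y ⊆ X → IsIndependent N X → IsIndependent N Y
  independent-⊆ {Y} {X} Y⊆X indX = ≤-antisym (rank-≤ Y) (+-cancelʳ-≤ ∣ X ─ Y ∣ _ _ (begin
    ∣ Y ∣ + ∣ X ─ Y ∣           ≡⟨ sym (p⊆q⇒∣q∣≡∣p∣+∣q─p∣ Y⊆X) ⟩
    ∣ X ∣                       ≡⟨ sym indX ⟩
    rank X                      ≤⟨ rank-mono (p⊆p─q∪q X Y) ⟩
    rank ((X ─ Y) ∪ Y)          ≤⟨ rank-∪≤ (X ─ Y) Y ⟩
    rank (X ─ Y) + rank Y       ≤⟨ +-monoˡ-≤ (rank Y) (rank-≤ (X ─ Y)) ⟩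
    ∣ X ─ Y ∣ + rank Y          ≡⟨ +-comm ∣ X ─ Y ∣ (rank Y) ⟩
    rank Y + ∣ X ─ Y ∣          ∎))
    where open ≤-Reasoning

  ∈cl⇒rank-∪⁅x⁆≡rank : x ∈ cl N X → rank (X ∪ ⁅ x ⁆) ≡ rank X
  ∈cl⇒rank-∪⁅x⁆≡rank {x} {X} x∈clX =
    toWitness (Equivalence.from T-≡ (trans (sym (lookup∘tabulate test x)) ([]=⇒lookup x∈clX)))
    where
    test : Fin n → Bool
    test e = ⌊ rank (X ∪ ⁅ e ⁆) ≟ rank X ⌋

  rank-∪⁅x⁆≡rank⇒∈cl : rank (X ∪ ⁅ x ⁆) ≡ rank X → x ∈ cl N X
  rank-∪⁅x⁆≡rank⇒∈cl {X} {x} eq =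
    lookup⇒[]= x (cl N X) (trans (lookup∘tabulate test x) (trans (isYes≗does x?) (dec-true x? eq)))
    where
    test : Fin n → Bool
    test e = ⌊ rank (X ∪ ⁅ e ⁆) ≟ rank X ⌋
    x? : Dec (rank (X ∪ ⁅ x ⁆) ≡ rank X)
    x? = rank (X ∪ ⁅ x ⁆) ≟ rank X

  X⊆clX : ∀ X → X ⊆ cl N X
  X⊆clX X x∈X = rank-∪⁅x⁆≡rank⇒∈cl (cong rank (x∈p⇒p∪⁅x⁆≡p x∈X))

  ⊆cl⇒rank-∪≡rank : ∀ A K → K ⊆ cl N A → rank (A ∪ K) ≡ rank A
  ⊆cl⇒rank-∪≡rank A K K⊆clA = go K K⊆clA (<-wellFounded ∣ K ∣)
    where
    go : ∀ K → K ⊆ cl N A → Acc _<_ ∣ K ∣ → rank (A ∪ K) ≡ rank A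
    go K K⊆clA (acc smaller) with nonempty? K
    ... | no  empty       = cong rank (trans (cong (A ∪_) (Empty-unique empty)) (∪-identityʳ A))
    ... | yes (w , w∈K) = ≤-antisym (+-cancelʳ-≤ (rank A) _ _ bound) (rank-mono (p⊆p∪q K))
      where
      rank-A∪K-w : rank (A ∪ (K - w)) ≡ rank A
      rank-A∪K-w = go (K - w) (⊆-trans (p─q⊆p K _) K⊆clA) (smaller (x∈p⇒∣p-x∣<∣p∣ w∈K))
      A∪K⊆ : A ∪ K ⊆ (A ∪ (K - w)) ∪ (A ∪ ⁅ w ⁆)
      A∪K⊆ = ∪-lub (⊆-trans (p⊆p∪q _) (p⊆p∪q _))
                   (⊆-trans (p⊆p─q∪q K ⁅ w ⁆) (∪-mono (q⊆p∪q A _) (q⊆p∪q A _)))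
      bound : rank (A ∪ K) + rank A ≤ rank A + rank A
      bound = begin
        rank (A ∪ K) + rank A
          ≤⟨ rank-submodular-⊆ A∪K⊆ (λ a∈A → x∈p∩q⁺ (p⊆p∪q _ a∈A , p⊆p∪q _ a∈A)) ⟩
        rank (A ∪ (K - w)) + rank (A ∪ ⁅ w ⁆)
          ≡⟨ cong₂ _+_ rank-A∪K-w (∈cl⇒rank-∪⁅x⁆≡rank (K⊆clA w∈K)) ⟩
        rank A + rank A
          ∎
        where open ≤-Reasoning

  ⊆cl⇒rank≤rank : X ⊆ cl N A → rank X ≤ rank A
  ⊆cl⇒rank≤rank {X} {A} X⊆clA = ≤-trans (rank-mono (q⊆p∪q A X)) (≤-reflexive (⊆cl⇒rank-∪≡rank A X X⊆clA))

  ¬independent-∪⁅x⁆⇒∈cl : IsIndependent N X → ¬ IsIndependent N (X ∪ ⁅ x ⁆) → x ∈ cl N X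
  ¬independent-∪⁅x⁆⇒∈cl {X} {x} indX ¬indX+x with x ∈? X
  ... | yes x∈X = X⊆clX X x∈X
  ... | no  x∉X = rank-∪⁅x⁆≡rank⇒∈cl
    (≤-antisym (s≤s⁻¹ (≤-trans rank<∣X∪x∣ (≤-reflexive ∣X∪x∣≡1+rank))) (rank-mono (p⊆p∪q _)))
    where
    ∣X∪x∣≡1+rank : ∣ X ∪ ⁅ x ⁆ ∣ ≡ suc (rank X)
    ∣X∪x∣≡1+rank = trans (x∉p⇒∣p∪⁅x⁆∣≡1+∣p∣ x∉X) (cong suc (sym indX))
    rank<∣X∪x∣ : rank (X ∪ ⁅ x ⁆) < ∣ X ∪ ⁅ x ⁆ ∣
    rank<∣X∪x∣ = ≤∧≢⇒< (rank-≤ _) ¬indX+x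

  independent-∪⁅x⁆⇒∉cl : x ∉ X → IsIndependent N (X ∪ ⁅ x ⁆) → x ∉ cl N X
  independent-∪⁅x⁆⇒∉cl {x} {X} x∉X indX+x x∈clX = 1+n≰n (begin
    suc ∣ X ∣         ≡⟨ sym (x∉p⇒∣p∪⁅x⁆∣≡1+∣p∣ x∉X) ⟩
    ∣ X ∪ ⁅ x ⁆ ∣     ≡⟨ sym indX+x ⟩
    rank (X ∪ ⁅ x ⁆)  ≡⟨ ∈cl⇒rank-∪⁅x⁆≡rank x∈clX ⟩
    rank X            ≤⟨ rank-≤ X ⟩
    ∣ X ∣             ∎)
    where open ≤-Reasoning

  ∈cl-∩ : ∀ {A B} → IsIndependent N (A ∪ B) → x ∈ cl N A → x ∈ cl N B → x ∈ cl N (A ∩ B)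
  ∈cl-∩ {x} {A} {B} indA∪B x∈clA x∈clB =
    rank-∪⁅x⁆≡rank⇒∈cl (≤-antisym (+-cancelˡ-≤ (rank (A ∪ B)) _ _ bound) (rank-mono (p⊆p∪q _)))
    where
    indA : IsIndependent N A
    indA = independent-⊆ (p⊆p∪q B) indA∪B
    indB : IsIndependent N B
    indB = independent-⊆ (q⊆p∪q A B) indA∪B
    indA∩B : IsIndependent N (A ∩ B)
    indA∩B = independent-⊆ (⊆-trans (p∩q⊆p A B) (p⊆p∪q B)) indA∪B
    bound : rank (A ∪ B) + rank ((A ∩ B) ∪ ⁅ x ⁆) ≤ rank (A ∪ B) + rank (A ∩ B)
    bound = begin
      rank (A ∪ B) + rank ((A ∩ B) ∪ ⁅ x ⁆)
        ≤⟨ rank-submodular-⊆ (∪-mono (p⊆p∪q _) (p⊆p∪q _)) (⊆-reflexive (∪-distribʳ-∩ ⁅ x ⁆ A B)) ⟩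
      rank (A ∪ ⁅ x ⁆) + rank (B ∪ ⁅ x ⁆)
        ≡⟨ cong₂ _+_ (trans (∈cl⇒rank-∪⁅x⁆≡rank x∈clA) indA) (trans (∈cl⇒rank-∪⁅x⁆≡rank x∈clB) indB) ⟩
      ∣ A ∣ + ∣ B ∣
        ≡⟨ sym (∣p∪q∣+∣p∩q∣≡∣p∣+∣q∣ A B) ⟩
      ∣ A ∪ B ∣ + ∣ A ∩ B ∣
        ≡⟨ sym (cong₂ _+_ indA∪B indA∩B) ⟩
      rank (A ∪ B) + rank (A ∩ B) ∎
      where open ≤-Reasoning

  dependent⇒circuit : rank X < ∣ X ∣ → ∃[ C ] (C ⊆ X × IsCircuit N C)
  dependent⇒circuit {X} depX = go X depX (<-wellFounded ∣ X ∣)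
    where
    go : ∀ X → rank X < ∣ X ∣ → Acc _<_ ∣ X ∣ → ∃[ C ] (C ⊆ X × IsCircuit N C)
    go X depX (acc smaller) with any? (λ w → (w ∈? X) ×-dec ¬? (rank (X - w) ≟ ∣ X - w ∣))
    ... | no  allIndependent = X , ⊆-refl , depX , independent-X-w
      where
      independent-X-w : ∀ w → w ∈ X → IsIndependent N (X - w)
      independent-X-w w w∈X with rank (X - w) ≟ ∣ X - w ∣
      ... | yes ind = ind
      ... | no  dep = ⊥-elim (allIndependent (w , w∈X , dep))
    ... | yes (w , w∈X , depX-w) with go (X - w) (≤∧≢⇒< (rank-≤ _) depX-w) (smaller (x∈p⇒∣p-x∣<∣p∣ w∈X))
    ...   | C , C⊆X-w , circuitC = C , ⊆-trans C⊆X-w (p─q⊆p X _) , circuitC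

  circuit⇒∣C∣≡1+rank : IsCircuit N C → ∣ C ∣ ≡ suc (rank C)
  circuit⇒∣C∣≡1+rank {C} (depC , minimal) with 1≤∣p∣⇒Nonempty (≤-trans (s≤s z≤n) depC)
  ... | c , c∈C = trans (x∈p⇒∣p∣≡1+∣p-x∣ c∈C) (cong suc (≤-antisym ∣C-c∣≤rank rank≤∣C-c∣))
    where
    ∣C-c∣≤rank : ∣ C - c ∣ ≤ rank C
    ∣C-c∣≤rank = ≤-trans (≤-reflexive (sym (minimal c c∈C))) (rank-mono (p─q⊆p C _))
    rank≤∣C-c∣ : rank C ≤ ∣ C - c ∣
    rank≤∣C-c∣ = s≤s⁻¹ (≤-trans depC (≤-reflexive (x∈p⇒∣p∣≡1+∣p-x∣ c∈C)))

  circuit-∣∣<⇒independent : IsCircuit N C → Y ⊆ C → ∣ Y ∣ < ∣ C ∣ → IsIndependent N Y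
  circuit-∣∣<⇒independent {C} {Y} (_ , minimal) Y⊆C ∣Y∣<∣C∣ = omit (1≤∣p∣⇒Nonempty 1≤∣C─Y∣)
    where
    1≤∣C─Y∣ : 1 ≤ ∣ C ─ Y ∣
    1≤∣C─Y∣ = +-cancelˡ-< (∣ Y ∣) 0 (∣ C ─ Y ∣)
                (subst₂ _<_ (sym (+-identityʳ _)) (p⊆q⇒∣q∣≡∣p∣+∣q─p∣ Y⊆C) ∣Y∣<∣C∣)
    omit : Nonempty (C ─ Y) → IsIndependent N Y
    omit (c , c∈C─Y) = independent-⊆ Y⊆C-c (minimal c (p─q⊆p C Y c∈C─Y))
      where
      Y⊆C-c : Y ⊆ C - c
      Y⊆C-c y∈Y = x∈p∧x≢y⇒x∈p-y (Y⊆C y∈Y) (λ { refl → x∈p─q⇒x∉q C Y c∈C─Y y∈Y })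

  SpannedBySubsetOf⇒∣B∩H∣≡rank : ∀ {B H} → IsIndependent N B → SpannedBySubsetOf N B H → ∣ B ∩ H ∣ ≡ rank H
  SpannedBySubsetOf⇒∣B∩H∣≡rank {B} {H} indB (S , S⊆B , clS≡H) =
    trans (sym indB∩H) (≤-antisym (rank-mono (p∩q⊆q B H)) rank-H≤)
    where
    indB∩H : IsIndependent N (B ∩ H)
    indB∩H = independent-⊆ (p∩q⊆p B H) indB
    S⊆B∩H : S ⊆ B ∩ H
    S⊆B∩H s∈S = x∈p∩q⁺ (S⊆B s∈S , subst (_ ∈_) clS≡H (X⊆clX S s∈S))
    rank-H≤ : rank H ≤ rank (B ∩ H)
    rank-H≤ = ≤-trans (⊆cl⇒rank≤rank (⊆-reflexive (sym clS≡H))) (rank-mono S⊆B∩H)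

  circuit-through-pair : ∀ {Z} → IsIndependent N (Z ∪ ⁅ x ⁆) → IsIndependent N (Z ∪ ⁅ y ⁆) →
                         rank ((Z ∪ ⁅ x ⁆) ∪ ⁅ y ⁆) < ∣ (Z ∪ ⁅ x ⁆) ∪ ⁅ y ⁆ ∣ →
                         ∃[ C ] (C ⊆ (Z ∪ ⁅ x ⁆) ∪ ⁅ y ⁆ × IsCircuit N C × x ∈ C × y ∈ C)
  circuit-through-pair {x} {y} {Z} indZ+x indZ+y depW with dependent⇒circuit depW
  ... | C , C⊆W , circuitC = C , C⊆W , circuitC , x∈C , y∈C
    where
    not-independent : ¬ IsIndependent N C
    not-independent = <⇒≢ (proj₁ circuitC)
    x∈C : x ∈ C
    x∈C with x ∈? C
    ... | yes x∈C = x∈C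
    ... | no  x∉C = ⊥-elim (not-independent (independent-⊆ C⊆Z+y indZ+y))
      where
      C⊆Z+y : C ⊆ Z ∪ ⁅ y ⁆
      C⊆Z+y = p⊆q∪⁅x⁆∧x∉p⇒p⊆q (subst (C ⊆_) (∪-swapʳ Z ⁅ x ⁆ ⁅ y ⁆) C⊆W) x∉C
    y∈C : y ∈ C
    y∈C with y ∈? C
    ... | yes y∈C = y∈C
    ... | no  y∉C = ⊥-elim (not-independent (independent-⊆ (p⊆q∪⁅x⁆∧x∉p⇒p⊆q C⊆W y∉C) indZ+x))

  cl-mono : C ⊆ F → cl N C ⊆ cl N F
  cl-mono {C} {F} C⊆F {x} x∈clC =
    rank-∪⁅x⁆≡rank⇒∈cl (≤-antisym (+-cancelʳ-≤ (rank C) _ _ bound) (rank-mono (p⊆p∪q _)))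
    where
    bound : rank (F ∪ ⁅ x ⁆) + rank C ≤ rank F + rank C
    bound = begin
      rank (F ∪ ⁅ x ⁆) + rank C  ≤⟨ rank-submodular-⊆ (∪-lub (p⊆p∪q _) (⊆-trans (q⊆p∪q C _) (q⊆p∪q F _)))
                                                           (λ c∈C → x∈p∩q⁺ (C⊆F c∈C , p⊆p∪q _ c∈C)) ⟩
      rank F + rank (C ∪ ⁅ x ⁆)  ≡⟨ cong (rank F +_) (∈cl⇒rank-∪⁅x⁆≡rank x∈clC) ⟩
      rank F + rank C            ∎
      where open ≤-Reasoning

  basic-circuit-⊇ : IsIndependent N B → IsBasicCircuit N B y C → SpannedBySubsetOf N B (cl N C) → B ∩ cl N C ⊆ C
  basic-circuit-⊇ {B} {y} {C} indB ((depC , _) , C⊆B∪y) spanned {b} b∈B∩clC with b ∈? C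
  ... | yes b∈C = b∈C
  ... | no  b∉C = ⊥-elim (<⇒≱ depC (begin
    ∣ C ∣                        ≤⟨ p⊆q⇒∣p∣≤∣q∣ C⊆ ⟩
    ∣ ((B ∩ cl N C) - b) ∪ ⁅ y ⁆ ∣  ≤⟨ ∣p∪q∣≤∣p∣+∣q∣ ((B ∩ cl N C) - b) ⁅ y ⁆ ⟩
    ∣ (B ∩ cl N C) - b ∣ + ∣ ⁅ y ⁆ ∣ ≡⟨ trans (cong (_ +_) (∣⁅x⁆∣≡1 y)) (+-comm _ 1) ⟩
    suc ∣ (B ∩ cl N C) - b ∣      ≡⟨ x∈p⇒∣p∣≡1+∣p-x∣ b∈B∩clC ⟨
    ∣ B ∩ cl N C ∣                ≡⟨ SpannedBySubsetOf⇒∣B∩H∣≡rank indB spanned ⟩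
    rank (cl N C)                ≤⟨ ⊆cl⇒rank≤rank ⊆-refl ⟩
    rank C                       ∎))
    where
    open ≤-Reasoning
    C⊆ : C ⊆ ((B ∩ cl N C) - b) ∪ ⁅ y ⁆
    C⊆ {c} c∈C with x∈p∪q⁻ B ⁅ y ⁆ (C⊆B∪y c∈C)
    ... | inj₂ c∈y = q⊆p∪q _ _ c∈y
    ... | inj₁ c∈B = p⊆p∪q _ (x∈p∧x≢y⇒x∈p-y (x∈p∩q⁺ (c∈B , X⊆clX C c∈C)) λ { refl → b∉C c∈C })

  rank-sandwich : ∀ {Y Z} → Z ⊆ Y → Y ⊆ cl N C → rank Z ≡ rank C → rank Y ≡ rank C
  rank-sandwich Z⊆Y Y⊆clC rankZ≡rankC =
    ≤-antisym (⊆cl⇒rank≤rank Y⊆clC) (≤-trans (≤-reflexive (sym rankZ≡rankC)) (rank-mono Z⊆Y))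

  circuit⇒rank-C-d≡rank : IsCircuit N C → y ∈ C → rank (C - y) ≡ rank C
  circuit⇒rank-C-d≡rank {C} {y} circuitC y∈C = suc-injective (begin
    suc (rank (C - y))  ≡⟨ cong suc (proj₂ circuitC y y∈C) ⟩
    suc ∣ C - y ∣       ≡⟨ x∈p⇒∣p∣≡1+∣p-x∣ y∈C ⟨
    ∣ C ∣               ≡⟨ circuit⇒∣C∣≡1+rank circuitC ⟩
    suc (rank C)        ∎)
    where open ≡-Reasoning

  ∣C∩F∣≡rank : IsIndependent N B → SpannedBySubsetOf N B F → B ∩ F ⊆ C →
                IsCircuit N C → ¬ C ⊆ F → ∣ C ∩ F ∣ ≡ rank F
  ∣C∩F∣≡rank {B} {F} {C} indB spannedF B∩F⊆C circuitC C⊈F = ≤-antisym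
    (≤-trans (≤-reflexive (sym independent-C∩F)) (rank-mono (p∩q⊆q C F)))
    (≤-trans (≤-reflexive (sym (SpannedBySubsetOf⇒∣B∩H∣≡rank indB spannedF))) (p⊆q⇒∣p∣≤∣q∣ B∩F⊆C∩F))
    where
    independent-C∩F : IsIndependent N (C ∩ F)
    independent-C∩F with ⊈⇒∃∉ C⊈F
    ... | y , y∈C , y∉F = independent-⊆ C∩F⊆C-y (proj₂ circuitC y y∈C)
      where
      C∩F⊆C-y : C ∩ F ⊆ C - y
      C∩F⊆C-y c∈C∩F with x∈p∩q⁻ C F c∈C∩F
      ... | c∈C , c∈F = x∈p∧x≢y⇒x∈p-y c∈C λ { refl → y∉F c∈F }
    B∩F⊆C∩F : B ∩ F ⊆ C ∩ F
    B∩F⊆C∩F b∈B∩F = x∈p∩q⁺ (B∩F⊆C b∈B∩F , p∩q⊆q B F b∈B∩F)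

-- Contraction

contraction : Matroid n → Subset n → Matroid n
contraction M F = record
  { rank      = contractRank M F
  ; rank-≤    = λ X → m≤n+o⇒m∸n≤o (rank (X ∪ F)) (rank F) (rank-∪F≤ X)
  ; rank-mono = λ X⊆Y → ∸-monoˡ-≤ (rank F) (rank-mono (∪-mono X⊆Y ⊆-refl))
  ; rank-sub  = λ X Y → ∸-mono-+-≤ (rank F) (rank-F≤ (X ∪ Y)) (rank-F≤ (X ∩ Y)) (rank-sub-∪F X Y)
  }
  where
  open Matroid M
  rank-∪F≤ : ∀ X → rank (X ∪ F) ≤ rank F + ∣ X ∣
  rank-∪F≤ X = ≤-trans (rank-∪≤ M X F)
                       (≤-trans (+-monoˡ-≤ (rank F) (rank-≤ X)) (≤-reflexive (+-comm ∣ X ∣ (rank F))))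
  rank-F≤ : ∀ X → rank F ≤ rank (X ∪ F)
  rank-F≤ X = rank-mono (q⊆p∪q X F)
  rank-sub-∪F : ∀ X Y → rank ((X ∪ Y) ∪ F) + rank ((X ∩ Y) ∪ F) ≤ rank (X ∪ F) + rank (Y ∪ F)
  rank-sub-∪F X Y = rank-submodular-⊆ M
    (∪-lub (∪-mono (p⊆p∪q F) (p⊆p∪q F)) (⊆-trans (q⊆p∪q X F) (p⊆p∪q _)))
    (⊆-reflexive (∪-distribʳ-∩ F X Y))

module _ (M : Matroid n) where
  open Matroid M

  private
    variable
      C F X : Subset n

  circuit⇒contraction-circuit : IsCircuit M C → F ⊆ cl M C → ∣ C ∩ F ∣ ≡ rank F →
                                IsCircuit (contraction M F) (C ─ F)
  circuit⇒contraction-circuit {C} {F} circuitC F⊆clC ∣C∩F∣≡rankF = dependent , minimal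
    where
    δ : ℕ
    δ = rank C ∸ rank F

    ∣C─F∣≡1+δ : ∣ C ─ F ∣ ≡ suc δ
    ∣C─F∣≡1+δ = +-cancelˡ-≡ (rank F) _ _ (begin
      rank F + ∣ C ─ F ∣      ≡⟨ cong (_+ ∣ C ─ F ∣) ∣C∩F∣≡rankF ⟨
      ∣ C ∩ F ∣ + ∣ C ─ F ∣   ≡⟨ ∣p∣≡∣p∩q∣+∣p─q∣ C F ⟨
      ∣ C ∣                   ≡⟨ circuit⇒∣C∣≡1+rank M circuitC ⟩
      suc (rank C)            ≡⟨ cong suc (m+[n∸m]≡n (⊆cl⇒rank≤rank M F⊆clC)) ⟨
      suc (rank F + δ)        ≡⟨ +-suc (rank F) δ ⟨
      rank F + suc δ          ∎)
      where open ≡-Reasoning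

    contractRank≡δ : ∀ {Y Z} → Z ⊆ Y ∪ F → Y ⊆ C → rank Z ≡ rank C → contractRank M F Y ≡ δ
    contractRank≡δ Z⊆Y∪F Y⊆C rankZ≡rankC =
      cong (_∸ rank F) (rank-sandwich M Z⊆Y∪F (∪-lub (⊆-trans Y⊆C (X⊆clX M C)) F⊆clC) rankZ≡rankC)

    dependent : contractRank M F (C ─ F) < ∣ C ─ F ∣
    dependent = ≤-trans (s≤s (≤-reflexive (contractRank≡δ (p⊆p─q∪q C F) (p─q⊆p C F) refl)))
                        (≤-reflexive (sym ∣C─F∣≡1+δ))

    minimal : ∀ d → d ∈ C ─ F → contractRank M F ((C ─ F) - d) ≡ ∣ (C ─ F) - d ∣
    minimal d d∈C─F = begin
      contractRank M F ((C ─ F) - d)  ≡⟨ contractRank≡δ (p-x⊆p─q-x∪q C F d) (⊆-trans (p─q⊆p _ _) (p─q⊆p C F))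
                                                         (circuit⇒rank-C-d≡rank M circuitC (p─q⊆p C F d∈C─F)) ⟩
      δ                               ≡⟨ suc-injective (trans (sym ∣C─F∣≡1+δ) (x∈p⇒∣p∣≡1+∣p-x∣ d∈C─F)) ⟩
      ∣ (C ─ F) - d ∣                 ∎
      where open ≡-Reasoning

  contractRank≤contractRank-C─F : F ⊆ cl M C → X ⊆ cl M C → contractRank M F X ≤ contractRank M F (C ─ F)
  contractRank≤contractRank-C─F {F} {C} {X} F⊆clC X⊆clC = ∸-monoˡ-≤ (rank F) (begin
    rank (X ∪ F)        ≤⟨ ⊆cl⇒rank≤rank M (∪-lub X⊆clC F⊆clC) ⟩
    rank C              ≡⟨ rank-sandwich M (p⊆p─q∪q C F) (∪-lub (⊆-trans (p─q⊆p C F) (X⊆clX M C)) F⊆clC) refl ⟨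
    rank ((C ─ F) ∪ F)  ∎)
    where open ≤-Reasoning

  flat⇒contraction-loopless : IsFlat M F → y ∉ F → 1 ≤ contractRank M F ⁅ y ⁆
  flat⇒contraction-loopless {F} {y} flatF y∉F =
    m<n⇒0<n∸m (≤∧≢⇒< (rank-mono (q⊆p∪q ⁅ y ⁆ F)) λ rankF≡ →
      y∉F (subst (y ∈_) flatF (rank-∪⁅x⁆≡rank⇒∈cl M (trans (cong rank (∪-comm F ⁅ y ⁆)) (sym rankF≡)))))

-- Matroids with a spanning circuit

CircuitThrough : Matroid n → Subset n → Fin n → Fin n → Set
CircuitThrough N E x y = ∃[ C ] (C ⊆ E × IsCircuit N C × x ∈ C × y ∈ C)

module SpanningCircuit (N : Matroid n) (E D : Subset n) (D⊆E : D ⊆ E) (circuitD : IsCircuit N D)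
                       (spanning : ∀ X → X ⊆ E → Matroid.rank N X ≤ Matroid.rank N D)
                       (loopless : ∀ x → x ∈ E → 1 ≤ Matroid.rank N ⁅ x ⁆) where
  open Matroid N

  k : ℕ
  k = rank D

  ∣D∣≡1+k : ∣ D ∣ ≡ suc k
  ∣D∣≡1+k = circuit⇒∣C∣≡1+rank N circuitD

  ⊆D∧∣∣≤k⇒independent : ∀ {Y} → Y ⊆ D → ∣ Y ∣ ≤ k → IsIndependent N Y
  ⊆D∧∣∣≤k⇒independent Y⊆D ∣Y∣≤k =
    circuit-∣∣<⇒independent N circuitD Y⊆D (≤-trans (s≤s ∣Y∣≤k) (≤-reflexive (sym ∣D∣≡1+k)))

  independent-⁅x⁆ : ∀ {x} → x ∈ E → IsIndependent N (⊥ ∪ ⁅ x ⁆)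
  independent-⁅x⁆ {x} x∈E rewrite ∪-identityˡ ⁅ x ⁆ =
    ≤-antisym (rank-≤ ⁅ x ⁆) (≤-trans (≤-reflexive (∣⁅x⁆∣≡1 x)) (loopless x x∈E))

  -- For x ∉ D take J ⊆ D − y maximal with J + x and J + y independent. Either J + x + y
  -- is dependent and its circuit passes through x and y, or it is a basis; then
  -- |J| = k − 2, and each of the 2 or 3 elements w of (D − y) ∖ J puts x or y into
  -- cl(J + w). Two of them doing so for the same z would put z into cl J, since
  -- cl A ∩ cl B = cl (A ∩ B) when A ∪ B is independent.
  module Pair {x y : Fin n} (x∈E : x ∈ E) (y∈E : y ∈ E) (x≢y : x ≢ y) (x∉D : x ∉ D) where

    D′ : Subset n
    D′ = D - y

    Extendable : Subset n → Set
    Extendable J = IsIndependent N (J ∪ ⁅ x ⁆) × IsIndependent N (J ∪ ⁅ y ⁆)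

    extendable? : ∀ J → Dec (Extendable J)
    extendable? J = (rank (J ∪ ⁅ x ⁆) ≟ ∣ J ∪ ⁅ x ⁆ ∣) ×-dec (rank (J ∪ ⁅ y ⁆) ≟ ∣ J ∪ ⁅ y ⁆ ∣)

    module _ {J : Subset n} (maximalJ : IsMaximalIn D′ Extendable J) where

      J⊆D′ : J ⊆ D′
      J⊆D′ = proj₁ maximalJ

      indJ+x : IsIndependent N (J ∪ ⁅ x ⁆)
      indJ+x = proj₁ (proj₁ (proj₂ maximalJ))

      indJ+y : IsIndependent N (J ∪ ⁅ y ⁆)
      indJ+y = proj₂ (proj₁ (proj₂ maximalJ))

      maximal : ∀ {w} → w ∈ D′ ─ J → ¬ Extendable (J ∪ ⁅ w ⁆)
      maximal = proj₂ (proj₂ maximalJ)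

      X : Subset n
      X = (J ∪ ⁅ x ⁆) ∪ ⁅ y ⁆

      J⊆D : J ⊆ D
      J⊆D = ⊆-trans J⊆D′ (p─q⊆p D _)

      x∉J : x ∉ J
      x∉J x∈J = x∉D (J⊆D x∈J)

      y∉J : y ∉ J
      y∉J y∈J = x∈p-y⇒x≢y D (J⊆D′ y∈J) refl

      X⊆E : X ⊆ E
      X⊆E = ∪-lub (∪-lub (⊆-trans J⊆D D⊆E) (x∈p⇒⁅x⁆⊆p x∈E)) (x∈p⇒⁅x⁆⊆p y∈E)

      ∣X∣≡2+∣J∣ : ∣ X ∣ ≡ suc (suc ∣ J ∣)
      ∣X∣≡2+∣J∣ = trans (x∉p⇒∣p∪⁅x⁆∣≡1+∣p∣ (x∉p∧x≢y⇒x∉p∪⁅y⁆ y∉J (x≢y ∘ sym)))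
                        (cong suc (x∉p⇒∣p∪⁅x⁆∣≡1+∣p∣ x∉J))

      J⊆X : J ⊆ X
      J⊆X = ⊆-trans (p⊆p∪q ⁅ x ⁆) (p⊆p∪q ⁅ y ⁆)

      x∈X : x ∈ X
      x∈X = p⊆p∪q ⁅ y ⁆ (q⊆p∪q J ⁅ x ⁆ (x∈⁅x⁆ x))

      y∈X : y ∈ X
      y∈X = q⊆p∪q (J ∪ ⁅ x ⁆) ⁅ y ⁆ (x∈⁅x⁆ y)

      D⊆clX : IsIndependent N X → D ⊆ cl N X
      D⊆clX indX {w} w∈D with w ∈? X
      ... | yes w∈X = X⊆clX N X w∈X
      ... | no  w∉X = ¬independent-∪⁅x⁆⇒∈cl N indX (λ indX+w → maximal w∈D′─J (extendable indX+w))
        where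
        w∈D′─J : w ∈ D′ ─ J
        w∈D′─J = x∈p∧x∉q⇒x∈p─q (x∈p∧x≢y⇒x∈p-y w∈D λ { refl → w∉X y∈X }) (w∉X ∘ J⊆X)
        J∪w∪z⊆X∪w : ∀ {z} → z ∈ X → (J ∪ ⁅ w ⁆) ∪ ⁅ z ⁆ ⊆ X ∪ ⁅ w ⁆
        J∪w∪z⊆X∪w z∈X = ∪-lub (∪-mono J⊆X ⊆-refl) (⊆-trans (x∈p⇒⁅x⁆⊆p z∈X) (p⊆p∪q _))
        extendable : IsIndependent N (X ∪ ⁅ w ⁆) → Extendable (J ∪ ⁅ w ⁆)
        extendable indX+w = independent-⊆ N (J∪w∪z⊆X∪w x∈X) indX+w , independent-⊆ N (J∪w∪z⊆X∪w y∈X) indX+w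

      independent-X⇒2+∣J∣≡k : IsIndependent N X → suc (suc ∣ J ∣) ≡ k
      independent-X⇒2+∣J∣≡k indX = begin
        suc (suc ∣ J ∣)  ≡⟨ ∣X∣≡2+∣J∣ ⟨
        ∣ X ∣            ≡⟨ indX ⟨
        rank X           ≡⟨ ≤-antisym (spanning X X⊆E) (⊆cl⇒rank≤rank N (D⊆clX indX)) ⟩
        k                ∎
        where open ≡-Reasoning

      module _ (2+∣J∣≡k : suc (suc ∣ J ∣) ≡ k) where

        J∪w⊆D : ∀ {w} → w ∈ D′ ─ J → J ∪ ⁅ w ⁆ ⊆ D
        J∪w⊆D w∈D′─J = ∪-lub J⊆D (x∈p⇒⁅x⁆⊆p (p─q⊆p D _ (p─q⊆p D′ J w∈D′─J)))

        independent-J∪w : ∀ {w} → w ∈ D′ ─ J → IsIndependent N (J ∪ ⁅ w ⁆)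
        independent-J∪w w∈D′─J = ⊆D∧∣∣≤k⇒independent (J∪w⊆D w∈D′─J) (begin
          ∣ J ∪ ⁅ _ ⁆ ∣    ≡⟨ x∉p⇒∣p∪⁅x⁆∣≡1+∣p∣ (x∈p─q⇒x∉q D′ J w∈D′─J) ⟩
          suc ∣ J ∣        ≤⟨ n≤1+n _ ⟩
          suc (suc ∣ J ∣)  ≡⟨ 2+∣J∣≡k ⟩
          k                ∎)
          where open ≤-Reasoning

        x-or-y-∈cl : ∀ {w} → w ∈ D′ ─ J → x ∈ cl N (J ∪ ⁅ w ⁆) ⊎ y ∈ cl N (J ∪ ⁅ w ⁆)
        x-or-y-∈cl {w} w∈D′─J with rank ((J ∪ ⁅ w ⁆) ∪ ⁅ x ⁆) ≟ ∣ (J ∪ ⁅ w ⁆) ∪ ⁅ x ⁆ ∣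
        ... | no  dependent   = inj₁ (¬independent-∪⁅x⁆⇒∈cl N (independent-J∪w w∈D′─J) dependent)
        ... | yes independent =
          inj₂ (¬independent-∪⁅x⁆⇒∈cl N (independent-J∪w w∈D′─J) (λ ind → maximal w∈D′─J (independent , ind)))

        AtMostOne-∈cl : ∀ {z} → z ∉ J → IsIndependent N (J ∪ ⁅ z ⁆) →
                        AtMostOne (D′ ─ J) (λ w → z ∈ cl N (J ∪ ⁅ w ⁆))
        AtMostOne-∈cl {z} z∉J indJ+z {a} {b} a∈ b∈ a≢b z∈cl-J+a z∈cl-J+b =
          independent-∪⁅x⁆⇒∉cl N z∉J indJ+z
            (subst (λ S → z ∈ cl N S) (x≢y⇒p∪⁅x⁆∩p∪⁅y⁆≡p a≢b) (∈cl-∩ N independent-J+a+b z∈cl-J+a z∈cl-J+b))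
          where
          independent-J+a+b : IsIndependent N ((J ∪ ⁅ a ⁆) ∪ (J ∪ ⁅ b ⁆))
          independent-J+a+b = ⊆D∧∣∣≤k⇒independent (∪-lub (J∪w⊆D a∈) (J∪w⊆D b∈))
            (≤-reflexive (trans (∣p∪⁅x⁆∪p∪⁅y⁆∣≡2+∣p∣ a≢b (x∈p─q⇒x∉q D′ J a∈) (x∈p─q⇒x∉q D′ J b∈)) 2+∣J∣≡k))

        ∣J∣+∣D′─J∣≡∣D′∣ : ∣ J ∣ + ∣ D′ ─ J ∣ ≡ ∣ D′ ∣
        ∣J∣+∣D′─J∣≡∣D′∣ = sym (p⊆q⇒∣q∣≡∣p∣+∣q─p∣ J⊆D′)

        y∈D⇒∣D′─J∣≡2 : y ∈ D → ∣ D′ ─ J ∣ ≡ 2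
        y∈D⇒∣D′─J∣≡2 y∈D = +-cancelˡ-≡ ∣ J ∣ _ _ (begin
          ∣ J ∣ + ∣ D′ ─ J ∣  ≡⟨ ∣J∣+∣D′─J∣≡∣D′∣ ⟩
          ∣ D - y ∣          ≡⟨ suc-injective (trans (sym (x∈p⇒∣p∣≡1+∣p-x∣ y∈D)) ∣D∣≡1+k) ⟩
          k                  ≡⟨ 2+∣J∣≡k ⟨
          2 + ∣ J ∣          ≡⟨ +-comm 2 ∣ J ∣ ⟩
          ∣ J ∣ + 2          ∎)
          where open ≡-Reasoning

        y∉D⇒∣D′─J∣≡3 : y ∉ D → ∣ D′ ─ J ∣ ≡ 3
        y∉D⇒∣D′─J∣≡3 y∉D = +-cancelˡ-≡ ∣ J ∣ _ _ (begin
          ∣ J ∣ + ∣ D′ ─ J ∣  ≡⟨ ∣J∣+∣D′─J∣≡∣D′∣ ⟩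
          ∣ D - y ∣          ≡⟨ cong ∣_∣ (x∉p⇒p-x≡p y∉D) ⟩
          ∣ D ∣              ≡⟨ ∣D∣≡1+k ⟩
          suc k              ≡⟨ cong suc 2+∣J∣≡k ⟨
          3 + ∣ J ∣          ≡⟨ +-comm 3 ∣ J ∣ ⟩
          ∣ J ∣ + 3          ∎)
          where open ≡-Reasoning

        y∈D⇒x∈cl : y ∈ D → ∀ {w} → w ∈ D′ ─ J → x ∈ cl N (J ∪ ⁅ w ⁆)
        y∈D⇒x∈cl y∈D {w} w∈D′─J with x-or-y-∈cl w∈D′─J
        ... | inj₁ x∈cl = x∈cl
        ... | inj₂ y∈cl = ⊥-elim (independent-∪⁅x⁆⇒∉cl N y∉J∪w independent-J∪w∪y y∈cl)
          where
          y∉J∪w : y ∉ J ∪ ⁅ w ⁆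
          y∉J∪w = x∉p∧x≢y⇒x∉p∪⁅y⁆ y∉J (λ { refl → x∈p-y⇒x≢y D (p─q⊆p D′ J w∈D′─J) refl })
          independent-J∪w∪y : IsIndependent N ((J ∪ ⁅ w ⁆) ∪ ⁅ y ⁆)
          independent-J∪w∪y = ⊆D∧∣∣≤k⇒independent (∪-lub (J∪w⊆D w∈D′─J) (x∈p⇒⁅x⁆⊆p y∈D))
            (≤-reflexive (trans (x∉p⇒∣p∪⁅x⁆∣≡1+∣p∣ y∉J∪w)
                                (trans (cong suc (x∉p⇒∣p∪⁅x⁆∣≡1+∣p∣ (x∈p─q⇒x∉q D′ J w∈D′─J))) 2+∣J∣≡k)))

        impossible : False
        impossible with y ∈? D
        ... | yes y∈D = AtMostOne-all⇒2≰∣p∣ (y∈D⇒x∈cl y∈D) (AtMostOne-∈cl x∉J indJ+x)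
                          (≤-reflexive (sym (y∈D⇒∣D′─J∣≡2 y∈D)))
        ... | no  y∉D = AtMostOne-cover⇒3≰∣p∣ x-or-y-∈cl (AtMostOne-∈cl x∉J indJ+x) (AtMostOne-∈cl y∉J indJ+y)
                          (≤-reflexive (sym (y∉D⇒∣D′─J∣≡3 y∉D)))

      circuit-through-x-y : CircuitThrough N E x y
      circuit-through-x-y with rank X <? ∣ X ∣
      ... | yes dependent with circuit-through-pair N indJ+x indJ+y dependent
      ...   | C , C⊆X , circuitC , x∈C , y∈C = C , ⊆-trans C⊆X X⊆E , circuitC , x∈C , y∈C
      circuit-through-x-y | no independent =
        ⊥-elim (impossible (independent-X⇒2+∣J∣≡k (≤-antisym (rank-≤ X) (≮⇒≥ independent))))

    circuit : CircuitThrough N E x y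
    circuit with maximal-extension Extendable extendable? D′ {⊥} (⊥-elim ∘ ∉⊥)
                                   (independent-⁅x⁆ x∈E , independent-⁅x⁆ y∈E)
    ... | J , maximalJ = circuit-through-x-y maximalJ

  connected : IsConnectedᵣ rank E
  connected = nonempty , circuit-through
    where
    nonempty : Nonempty E
    nonempty with 1≤∣p∣⇒Nonempty (≤-trans (s≤s z≤n) (≤-reflexive (sym ∣D∣≡1+k)))
    ... | d , d∈D = d , D⊆E d∈D
    circuit-through : ∀ x y → x ∈ E → y ∈ E → x ≢ y → CircuitThrough N E x y
    circuit-through x y x∈E y∈E x≢y with x ∈? D | y ∈? D
    ... | yes x∈D | yes y∈D = D , D⊆E , circuitD , x∈D , y∈D
    ... | no  x∉D | _       = Pair.circuit x∈E y∈E x≢y x∉D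
    ... | yes _   | no  y∉D with Pair.circuit y∈E x∈E (x≢y ∘ sym) y∉D
    ...   | C , C⊆E , circuitC , y∈C , x∈C = C , C⊆E , circuitC , x∈C , y∈C

mainTheorem5 : ∀ {n} (M : Matroid n) (B F G : Subset n) →
    IsCircuitous M B →
    IsFlat M F → SpannedBySubsetOf M B F →
    IsFlat M G → SpannedBySubsetOf M B G →
    F ⊂ G →
    IsConnectedᵣ (Matroid.rank M) G →
    IsConnectedMinor M G F
mainTheorem5 M B F G ((indB , _) , circuitous) flatF spannedF flatG spannedG (F⊆G , g , g∈G , g∉F) connectedG
  with circuitous G (flatG , connectedG) spannedG
... | _ , _ , C , basicC@(circuitC , _) , refl =
  SpanningCircuit.connected (contraction M F) (cl M C ─ F) (C ─ F) (─-monoˡ (X⊆clX M C))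
    (circuit⇒contraction-circuit M circuitC F⊆G (∣C∩F∣≡rank M indB spannedF B∩F⊆C circuitC C⊈F))
    (λ X X⊆clC─F → contractRank≤contractRank-C─F M F⊆G (⊆-trans X⊆clC─F (p─q⊆p _ F)))
    (λ x x∈clC─F → flat⇒contraction-loopless M flatF (x∈p─q⇒x∉q _ F x∈clC─F))
  where
  B∩F⊆C : B ∩ F ⊆ C
  B∩F⊆C b∈B∩F with x∈p∩q⁻ B F b∈B∩F
  ... | b∈B , b∈F = basic-circuit-⊇ M indB basicC spannedG (x∈p∩q⁺ (b∈B , F⊆G b∈F))
  C⊈F : ¬ C ⊆ F
  C⊈F C⊆F = g∉F (subst (g ∈_) flatF (cl-mono M C⊆F g∈G))
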